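{- Let $S$ be a spanning tree that is strongly stable on $A\subseteq V$ and also strongly stable on $B\subseteq V$. Then $S$ is strongly stable on $Q=A\cup B$.
   Context: $G=(V,A_G)$ is a directed graph with sink $r$; each node $v\neq r$ has a strict ranking of its out-neighbours. A spanning tree $S$ is a spanning in-arborescence of $G$ rooted at $r$; for $(v,w)\in S$, $w$ is the parent of $v$. For $Q\subseteq V$ and $v\in Q$, the $Q$-subtree of $v$ with respect to $S$ is the maximal subtree rooted at $v$ of the forest $S[Q]$ (the subgraph of $S$ induced by $Q$), i.e. $v$ together with all nodes of $Q$ whose path to $v$ in $S$ stays inside $Q$. $S$ is strongly stable on a set $\mathbb{O}$ if every node $v\in\mathbb{O}$ with $(v,w)\in S$ prefers its parent $w$ to every other out-neighbour of $v$ lying outside the $\mathbb{O}$-subtree of $v$. -}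

module Defs where

open import Data.Nat using (ℕ; _<_)
open import Data.Fin using (Fin)
open import Data.Product using (Σ; _×_; _,_)
open import Data.Empty using (⊥)
open import Relation.Nullary using (¬_)
open import Relation.Unary using (Pred)
open import Relation.Binary.PropositionalEquality using (_≡_; _≢_)
open import Level using (0ℓ)

record PrefGraph (n : ℕ) : Set₁ where
  field
    Arc  : Fin n → Fin n → Set
    r    : Fin n
    sink : ∀ w → ¬ Arc r w
    -- strict ranking of out-neighbours: rank v w (smaller = more preferred),
    -- injective on the out-neighbours of each v ≠ r
    rank     : Fin n → Fin n → ℕ
    rank-inj : ∀ v w w' → v ≢ r → Arc v w → Arc v w' → rank v w ≡ rank v w' → w ≡ w'

  Prefers : Fin n → Fin n → Fin n → Set
  Prefers v w u = rank v w < rank v u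

data Reach {n : ℕ} (S : Fin n → Fin n → Set) : Fin n → Fin n → Set where
  here : ∀ {u} → Reach S u u
  step : ∀ {u x v} → S u x → Reach S x v → Reach S u v

module _ {n : ℕ} (G : PrefGraph n) where
  open PrefGraph G

  record SpanningTree (S : Fin n → Fin n → Set) : Set where
    field
      sub       : ∀ v w → S v w → Arc v w
      root-none : ∀ w → ¬ S r w
      parent    : ∀ v → v ≢ r → Σ (Fin n) (λ w → S v w)
      unique    : ∀ v w w' → S v w → S v w' → w ≡ w'
      reach     : ∀ v → Reach S v r

-- u lies in the Q-subtree of v w.r.t. S: there is an S-path from u to v
-- all of whose nodes lie in Q (v itself must lie in Q).
data InSubtree {n : ℕ} (S : Fin n → Fin n → Set) (Q : Pred (Fin n) 0ℓ)
       : Fin n → Fin n → Set where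
  here : ∀ {v} → Q v → InSubtree S Q v v
  step : ∀ {u x v} → Q u → S u x → InSubtree S Q x v → InSubtree S Q u v

StronglyStable : ∀ {n} (G : PrefGraph n) (S : Fin n → Fin n → Set)
                 (O : Pred (Fin n) 0ℓ) → Set
StronglyStable {n} G S O =
  ∀ v w → O v → S v w →
  ∀ u → PrefGraph.Arc G v u → u ≢ w → ¬ InSubtree S O u v →
  PrefGraph.Prefers G v w u

module Submission where

open import Defs
open import Data.Nat using (ℕ)
open import Data.Fin using (Fin)
open import Data.Sum using (inj₁; inj₂)
open import Level using (0ℓ)
open import Relation.Binary.PropositionalEquality using (_≢_)
open import Relation.Nullary using (¬_)
open import Relation.Unary using (Pred; _⊆_; _∪_)

-- A node of A ∪ B lies in A or in B, and enlarging O only enlarges the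
-- O-subtrees, so fewer out-neighbours have to be beaten by the parent.

InSubtree-mono : ∀ {n} {S : Fin n → Fin n → Set} {P Q : Pred (Fin n) 0ℓ} →
                 P ⊆ Q → ∀ {u v} → InSubtree S P u v → InSubtree S Q u v
InSubtree-mono P⊆Q (here p)     = here (P⊆Q p)
InSubtree-mono P⊆Q (step p s t) = step (P⊆Q p) s (InSubtree-mono P⊆Q t)

StronglyStable-restrict : ∀ {n} (G : PrefGraph n) (S : Fin n → Fin n → Set)
                          {P Q : Pred (Fin n) 0ℓ} → P ⊆ Q →
                          StronglyStable G S P →
                          ∀ v w → P v → S v w →
                          ∀ u → PrefGraph.Arc G v u → u ≢ w → ¬ InSubtree S Q u v →
                          PrefGraph.Prefers G v w u
StronglyStable-restrict G S P⊆Q stable v w p s u arc u≢w u∉Q =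
  stable v w p s u arc u≢w (λ u∈P → u∉Q (InSubtree-mono P⊆Q u∈P))

lemma4 : ∀ {n} (G : PrefGraph n) (S : Fin n → Fin n → Set) →
         SpanningTree G S →
         (A B : Pred (Fin n) 0ℓ) →
         StronglyStable G S A → StronglyStable G S B →
         StronglyStable G S (A ∪ B)
lemma4 G S _ A B stableA stableB v w (inj₁ a) =
  StronglyStable-restrict G S inj₁ stableA v w a
lemma4 G S _ A B stableA stableB v w (inj₂ b) =
  StronglyStable-restrict G S inj₂ stableB v w b
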